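{- For all $k\in\mathbb{N}$ and all sets of $k$ distinct indices $\{i_1,\dots,i_k\}\subseteq[n]$, \[1=\sum_{\pi\in S_k}\prod_{j=1}^{k-1}x_{i_{\pi(j)}i_{\pi(j+1)}}\] follows from the ordering and transitivity axioms by a degree $k+1$ proof using only polynomial equalities; that is, $1-\sum_{\pi\in S_k}\prod_{j=1}^{k-1}x_{i_{\pi(j)}i_{\pi(j+1)}}=\sum_t f_ts_t$ for some polynomials $f_t$ and ordering/transitivity axioms $s_t=0$ with $\deg(f_t)+\deg(s_t)\le k+1$.
   Context: Variables $x_{ij}$ for $i,j\in[n]$, $i\neq j$. The ordering axioms are $x_{ij}^2-x_{ij}=0$ and $x_{ij}-(1-x_{ji})=0$ for all $i\neq j$; the transitivity axioms are $x_{ij}x_{jk}(1-x_{ik})=0$ for all distinct $i,j,k$. -}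

module Defs where

open import Data.Nat using (ℕ; zero; suc; _+_; _⊔_)
open import Data.Bool using (Bool; true; false; if_then_else_; _∧_)
open import Data.Fin using (Fin)
open import Data.Fin.Properties using () renaming (_≟_ to _≟ᶠ_)
open import Data.Vec using (Vec; replicate; zipWith; tabulate; lookup)
import Data.Vec as V
open import Data.Vec.Properties using (≡-dec)
import Data.Nat.Properties as ℕP
open import Data.List using (List; []; _∷_; [_]; map; concatMap; foldr; _++_)
open import Data.Product using (_×_; _,_; Σ)
open import Data.Rational using (ℚ; 0ℚ; 1ℚ; -_) renaming (_+_ to _+ℚ_; _*_ to _*ℚ_)
import Data.Rational.Properties as ℚP
open import Relation.Nullary using (¬_; Dec; yes; no; does)
open import Relation.Binary.PropositionalEquality using (_≡_; _≢_)

-- A monomial is its exponent matrix (entry (i,j) = exponent of x_ij).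
-- Diagonal entries correspond to no variable of the paper; polynomials
-- are required not to use them via `InVars`.

Mono : ℕ → Set
Mono n = Vec (Vec ℕ n) n

_≟ₘ_ : ∀ {n} (m m' : Mono n) → Dec (m ≡ m')
_≟ₘ_ = ≡-dec (≡-dec ℕP._≟_)

one-mono : ∀ {n} → Mono n
one-mono = replicate _ (replicate _ 0)

mono-mul : ∀ {n} → Mono n → Mono n → Mono n
mono-mul = zipWith (zipWith _+_)

var-mono : ∀ {n} → Fin n → Fin n → Mono n
var-mono i j = tabulate λ a → tabulate λ b →
  if does (a ≟ᶠ i) ∧ does (b ≟ᶠ j) then 1 else 0

mono-deg : ∀ {n} → Mono n → ℕ
mono-deg m = V.sum (V.map V.sum m)

Poly : ℕ → Set
Poly n = List (ℚ × Mono n)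

coeff : ∀ {n} → Poly n → Mono n → ℚ
coeff [] m = 0ℚ
coeff ((c , m') ∷ p) m = if does (m' ≟ₘ m) then c +ℚ coeff p m else coeff p m

infix 4 _≈_
_≈_ : ∀ {n} → Poly n → Poly n → Set
p ≈ q = ∀ m → coeff p m ≡ coeff q m

InVars : ∀ {n} → Poly n → Set
InVars {n} p = ∀ m → coeff p m ≢ 0ℚ → ∀ (a : Fin n) → lookup (lookup m a) a ≡ 0

-- (true) total degree: max degree of monomials with nonzero coefficient
-- (the zero polynomial gets degree 0)
deg : ∀ {n} → Poly n → ℕ
deg p = foldr (λ t acc → let m = Data.Product.proj₂ t in
                  if does (coeff p m ℚP.≟ 0ℚ) then acc else mono-deg m ⊔ acc) 0 p

const : ∀ {n} → ℚ → Poly n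
const c = [ (c , one-mono) ]

var : ∀ {n} → Fin n → Fin n → Poly n
var i j = [ (1ℚ , var-mono i j) ]

infixl 6 _⊕_
infixl 7 _⊗_
_⊕_ : ∀ {n} → Poly n → Poly n → Poly n
_⊕_ = _++_

⊖_ : ∀ {n} → Poly n → Poly n
⊖ p = map (λ t → (- Data.Product.proj₁ t , Data.Product.proj₂ t)) p

_⊗_ : ∀ {n} → Poly n → Poly n → Poly n
p ⊗ q = concatMap (λ t → map (λ u → (Data.Product.proj₁ t *ℚ Data.Product.proj₁ u ,
                                      mono-mul (Data.Product.proj₂ t) (Data.Product.proj₂ u))) q) p

sumPoly : ∀ {n} → List (Poly n) → Poly n
sumPoly = foldr _⊕_ []

-- Ordering and transitivity axioms (each axiom s is the polynomial s = 0)

data Axiom (n : ℕ) : Set where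
  ax-bool  : (i j : Fin n) → i ≢ j → Axiom n
  ax-anti  : (i j : Fin n) → i ≢ j → Axiom n
  ax-trans : (i j k : Fin n) → i ≢ j → j ≢ k → i ≢ k → Axiom n

axiomPoly : ∀ {n} → Axiom n → Poly n
axiomPoly (ax-bool i j _) = var i j ⊗ var i j ⊕ ⊖ var i j
axiomPoly (ax-anti i j _) = var i j ⊕ ⊖ (const 1ℚ ⊕ ⊖ var j i)
axiomPoly (ax-trans i j k _ _ _) = var i j ⊗ var j k ⊗ (const 1ℚ ⊕ ⊖ var i k)

insertions : ∀ {A : Set} → A → List A → List (List A)
insertions x [] = [ [ x ] ]
insertions x (y ∷ ys) = (x ∷ y ∷ ys) ∷ map (y ∷_) (insertions x ys)

perms : ∀ {A : Set} → List A → List (List A)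
perms [] = [ [] ]
perms (x ∷ xs) = concatMap (insertions x) (perms xs)

pathProd' : ∀ {n} → Fin n → List (Fin n) → Poly n
pathProd' a [] = const 1ℚ
pathProd' a (b ∷ rest) = var a b ⊗ pathProd' b rest

pathProd : ∀ {n} → List (Fin n) → Poly n
pathProd [] = const 1ℚ
pathProd (a ∷ rest) = pathProd' a rest

-- Write P(a₁ ⋯ aₘ) = x_{a₁a₂} ⋯ x_{aₘ₋₁aₘ}. The permutations of x ∷ L are the insertions of x
-- into the permutations σ of L, so by induction on L it suffices to derive
-- P(σ) = Σ_{τ an insertion of x into σ} P(τ) in degree |σ| + 1. Antisymmetry splits P(aρ) into
-- x_{xa} P(aρ), which is x inserted in front, and x_{ax} P(aρ), which is pushed along the path by
-- x_{ax} x_{ab} = x_{ax} x_{xb} + x_{ab} x_{bx}: a degree-3 consequence of two transitivity axioms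
-- and one antisymmetry axiom, multiplied by a path product of degree |ρ|.

module Submission where

open import Defs
open import Data.Nat using (ℕ; zero; suc; _+_; _≤_; _⊔_; z≤n; s≤s)
import Data.Nat.Properties as ℕP
open import Data.Fin as Fin using (Fin)
import Data.Fin.Properties as FinP
open import Data.List using (List; []; _∷_; map; _++_; concat; concatMap; foldr; [_]; length; allFin)
import Data.List.Properties as ListP
import Data.Vec.Properties as VecP
open import Data.Vec as Vec using (Vec; []; _∷_; zipWith; replicate; lookup; tabulate)
open import Data.List.Relation.Unary.All as All using (All; []; _∷_)
import Data.List.Relation.Unary.All.Properties as AllP
open import Function using (_∘_; id)
open import Function.Definitions using (Injective)
open import Data.Product using (Σ; _×_; _,_; proj₁; proj₂)
open import Data.Rational using (ℚ; 0ℚ; 1ℚ) renaming (_+_ to _+ℚ_; _*_ to _*ℚ_; -_ to -ℚ_)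
import Data.Rational.Properties as ℚP
open import Data.Rational.Solver using (module +-*-Solver)
open import Data.Maybe using (Maybe; just; nothing)
open import Data.Bool using (true; false; if_then_else_; _∧_)
open import Data.Empty using (⊥-elim)
open import Data.List.Relation.Unary.Unique.Propositional using (Unique)
import Data.List.Relation.Unary.Unique.Propositional.Properties as UniqueP
open import Data.List.Relation.Unary.AllPairs using ([]; _∷_)
open import Data.List.Relation.Binary.Permutation.Propositional
  using (_↭_; ↭-refl; ↭-prep; ↭-swap; ↭-trans; ↭-sym; ↭⇒↭ₛ)
open import Data.List.Relation.Binary.Permutation.Propositional.Properties using (All-resp-↭; ↭-length)
open import Relation.Nullary using (yes; no; does)
open import Relation.Binary.PropositionalEquality hiding ([_])
open import Algebra.Bundles using (CommutativeRing)
open import Algebra.Structures using (IsCommutativeRing)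
open import Relation.Binary.Bundles using (Setoid)
open import Level using (0ℓ)
open import Algebra.Consequences.Setoid using (comm∧idˡ⇒id; comm∧invˡ⇒inv; comm∧distrˡ⇒distr)
open import Algebra.Solver.Ring.AlmostCommutativeRing
  using (AlmostCommutativeRing; fromCommutativeRing; _-Raw-AlmostCommutative⟶_)
import Algebra.Solver.Ring
open import Algebra.Properties.Group ℚP.+-0-group using (x∙y⁻¹≈ε⇒x≈y)
open import Algebra.Properties.CommutativeSemigroup ℕP.+-commutativeSemigroup
  using () renaming (interchange to +-interchange)

module _ {A : Set} where

  open import Data.List.Relation.Binary.Permutation.Setoid.Properties (setoid A)
    using () renaming (Unique-resp-↭ to Unique-resp-↭ₛ)

  insertions-↭ : ∀ (x : A) σ → All (_↭ x ∷ σ) (insertions x σ)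
  insertions-↭ x []      = ↭-refl ∷ []
  insertions-↭ x (y ∷ σ) =
    ↭-refl ∷ AllP.map⁺ (All.map (λ τ↭xσ → ↭-trans (↭-prep y τ↭xσ) (↭-swap y x ↭-refl)) (insertions-↭ x σ))

  perms-↭ : ∀ (xs : List A) → All (_↭ xs) (perms xs)
  perms-↭ []       = ↭-refl ∷ []
  perms-↭ (x ∷ xs) = AllP.concat⁺ (AllP.map⁺ (All.map insertions-of-perm (perms-↭ xs)))
    where
    insertions-of-perm : ∀ {σ} → σ ↭ xs → All (_↭ x ∷ xs) (insertions x σ)
    insertions-of-perm σ↭xs = All.map (λ τ↭xσ → ↭-trans τ↭xσ (↭-prep x σ↭xs)) (insertions-↭ x _)

  Unique-resp-↭ : ∀ {xs ys : List A} → xs ↭ ys → Unique xs → Unique ys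
  Unique-resp-↭ = Unique-resp-↭ₛ ∘ ↭⇒↭ₛ

module _ {n : ℕ} where

  DiagonalFree : Mono n → Set
  DiagonalFree m = ∀ a → lookup (lookup m a) a ≡ 0

  mono-mul-comm : ∀ (a b : Mono n) → mono-mul a b ≡ mono-mul b a
  mono-mul-comm = VecP.zipWith-comm (VecP.zipWith-comm ℕP.+-comm)

  mono-mul-assoc : ∀ (a b c : Mono n) → mono-mul (mono-mul a b) c ≡ mono-mul a (mono-mul b c)
  mono-mul-assoc = VecP.zipWith-assoc (VecP.zipWith-assoc ℕP.+-assoc)

  mono-mul-identityˡ : ∀ (a : Mono n) → mono-mul one-mono a ≡ a
  mono-mul-identityˡ = VecP.zipWith-identityˡ (VecP.zipWith-identityˡ ℕP.+-identityˡ)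

  mono-deg-mul : ∀ (a b : Mono n) → mono-deg (mono-mul a b) ≡ mono-deg a + mono-deg b
  mono-deg-mul = sum-sums-zipWith
    where
    sum-zipWith : ∀ {k} (u v : Vec ℕ k) → Vec.sum (zipWith _+_ u v) ≡ Vec.sum u + Vec.sum v
    sum-zipWith []      []      = refl
    sum-zipWith (x ∷ u) (y ∷ v) = trans (cong (x + y +_) (sum-zipWith u v)) (+-interchange x y (Vec.sum u) (Vec.sum v))
    sum-sums-zipWith : ∀ {k l} (a b : Vec (Vec ℕ l) k) →
      Vec.sum (Vec.map Vec.sum (zipWith (zipWith _+_) a b)) ≡ Vec.sum (Vec.map Vec.sum a) + Vec.sum (Vec.map Vec.sum b)
    sum-sums-zipWith []      []      = refl
    sum-sums-zipWith (r ∷ a) (s ∷ b) =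
      trans (cong₂ _+_ (sum-zipWith r s) (sum-sums-zipWith a b)) (+-interchange (Vec.sum r) (Vec.sum s) _ _)

  mono-deg-one : mono-deg (one-mono {n}) ≡ 0
  mono-deg-one = begin
    Vec.sum (Vec.map Vec.sum (replicate n (replicate n 0)))  ≡⟨ cong Vec.sum (VecP.map-replicate Vec.sum (replicate n 0) n) ⟩
    Vec.sum (replicate n (Vec.sum (replicate n 0)))          ≡⟨ cong (Vec.sum ∘ replicate n) (sum-zeros n) ⟩
    Vec.sum (replicate n 0)                                  ≡⟨ sum-zeros n ⟩
    0                                                        ∎
    where
    open ≡-Reasoning
    sum-zeros : ∀ k → Vec.sum (replicate k 0) ≡ 0
    sum-zeros zero    = refl
    sum-zeros (suc k) = sum-zeros k

  mono-deg-var : ∀ (i j : Fin n) → mono-deg (var-mono i j) ≡ 1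
  mono-deg-var i j = begin
    Vec.sum (Vec.map Vec.sum (var-mono i j))   ≡⟨ cong Vec.sum (VecP.tabulate-∘ Vec.sum row) ⟨
    Vec.sum (tabulate λ a → Vec.sum (row a))   ≡⟨ cong Vec.sum (VecP.tabulate-cong row-sum) ⟩
    Vec.sum (tabulate (indicator i))           ≡⟨ sum-indicator i ⟩
    1                                          ∎
    where
    open ≡-Reasoning
    indicator : ∀ {k} → Fin k → Fin k → ℕ
    indicator i a = if does (a FinP.≟ i) then 1 else 0
    row : Fin n → Vec ℕ n
    row a = tabulate λ b → if does (a FinP.≟ i) ∧ does (b FinP.≟ j) then 1 else 0
    sum-zeros : ∀ {k} {f : Fin k → ℕ} → (∀ b → f b ≡ 0) → Vec.sum (tabulate f) ≡ 0
    sum-zeros {zero}  f≗0 = refl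
    sum-zeros {suc k} f≗0 = cong₂ _+_ (f≗0 Fin.zero) (sum-zeros (f≗0 ∘ Fin.suc))
    sum-indicator : ∀ {k} (i : Fin k) → Vec.sum (tabulate (indicator i)) ≡ 1
    sum-indicator {suc k} Fin.zero = cong suc (sum-zeros {k} λ _ → refl)
    sum-indicator (Fin.suc i)      = sum-indicator i
    row-sum : ∀ a → Vec.sum (row a) ≡ indicator i a
    row-sum a with does (a FinP.≟ i)
    ... | true  = sum-indicator j
    ... | false = sum-zeros {n} λ _ → refl

  DiagonalFree-mul : ∀ {a b : Mono n} → DiagonalFree a → DiagonalFree b → DiagonalFree (mono-mul a b)
  DiagonalFree-mul {a} {b} a-free b-free i
    rewrite VecP.lookup-zipWith (zipWith _+_) i a b | VecP.lookup-zipWith _+_ i (lookup a i) (lookup b i)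
          | a-free i | b-free i = refl

  DiagonalFree-one : DiagonalFree (one-mono {n})
  DiagonalFree-one i rewrite VecP.lookup-replicate i (replicate n 0) | VecP.lookup-replicate i 0 = refl

  DiagonalFree-var : ∀ {i j : Fin n} → i ≢ j → DiagonalFree (var-mono i j)
  DiagonalFree-var {i} {j} i≢j a
    rewrite VecP.lookup∘tabulate (λ a → tabulate λ b → if does (a FinP.≟ i) ∧ does (b FinP.≟ j) then 1 else 0) a
          | VecP.lookup∘tabulate (λ b → if does (a FinP.≟ i) ∧ does (b FinP.≟ j) then 1 else 0) a
    with a FinP.≟ i | a FinP.≟ j
  ... | yes refl | yes refl = ⊥-elim (i≢j refl)
  ... | yes _    | no _     = refl
  ... | no _     | _        = refl

-- Polynomials up to coefficientwise equality form a commutative ring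

module _ {n : ℕ} where

  open +-*-Solver using (solve; _:+_; _:*_; :-_; _:=_; con)

  -- Ring laws are checked through the linear functionals linExt h, which depend only on
  -- coefficients and, for h = δ m, recover them.
  linExt : (Mono n → ℚ) → Poly n → ℚ
  linExt h [] = 0ℚ
  linExt h ((c , m) ∷ p) = c *ℚ h m +ℚ linExt h p

  linExt-cong : ∀ {h h′ : Mono n → ℚ} → (∀ m → h m ≡ h′ m) → ∀ p → linExt h p ≡ linExt h′ p
  linExt-cong h≗h′ [] = refl
  linExt-cong h≗h′ ((c , m) ∷ p) = cong₂ (λ x y → c *ℚ x +ℚ y) (h≗h′ m) (linExt-cong h≗h′ p)

  linExt-++ : ∀ h (p q : Poly n) → linExt h (p ++ q) ≡ linExt h p +ℚ linExt h q
  linExt-++ h [] q = sym (ℚP.+-identityˡ _)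
  linExt-++ h ((c , m) ∷ p) q = begin
    c *ℚ h m +ℚ linExt h (p ++ q)            ≡⟨ cong (c *ℚ h m +ℚ_) (linExt-++ h p q) ⟩
    c *ℚ h m +ℚ (linExt h p +ℚ linExt h q)   ≡⟨ ℚP.+-assoc (c *ℚ h m) _ _ ⟨
    c *ℚ h m +ℚ linExt h p +ℚ linExt h q     ∎
    where open ≡-Reasoning

  linExt-⊖ : ∀ h (p : Poly n) → linExt h (⊖ p) ≡ -ℚ linExt h p
  linExt-⊖ h [] = refl
  linExt-⊖ h ((c , m) ∷ p) rewrite linExt-⊖ h p =
    solve 3 (λ c x w → (:- c) :* x :+ :- w := :- (c :* x :+ w)) refl c (h m) (linExt h p)

  linExt-zero : ∀ (p : Poly n) → linExt (λ _ → 0ℚ) p ≡ 0ℚ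
  linExt-zero [] = refl
  linExt-zero ((c , m) ∷ p) rewrite linExt-zero p | ℚP.*-zeroʳ c = refl

  linExt-+ : ∀ (f g : Mono n → ℚ) p → linExt (λ m → f m +ℚ g m) p ≡ linExt f p +ℚ linExt g p
  linExt-+ f g [] = sym (ℚP.+-identityˡ 0ℚ)
  linExt-+ f g ((c , m) ∷ p) rewrite linExt-+ f g p =
    solve 5 (λ c x y u v → c :* (x :+ y) :+ (u :+ v) := (c :* x :+ u) :+ (c :* y :+ v))
      refl c (f m) (g m) (linExt f p) (linExt g p)

  linExt-* : ∀ a (f : Mono n → ℚ) p → linExt (λ m → a *ℚ f m) p ≡ a *ℚ linExt f p
  linExt-* a f [] = sym (ℚP.*-zeroʳ a)
  linExt-* a f ((c , m) ∷ p) rewrite linExt-* a f p =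
    solve 4 (λ a c x w → c :* (a :* x) :+ a :* w := a :* (c :* x :+ w))
      refl a c (f m) (linExt f p)

  linExt-⊗ : ∀ h (p q : Poly n) → linExt h (p ⊗ q) ≡ linExt (λ a → linExt (λ b → h (mono-mul a b)) q) p
  linExt-⊗ h [] q = refl
  linExt-⊗ h ((c , a) ∷ p) q = begin
    linExt h (scaled q ++ p ⊗ q)                   ≡⟨ linExt-++ h (scaled q) (p ⊗ q) ⟩
    linExt h (scaled q) +ℚ linExt h (p ⊗ q)        ≡⟨ cong₂ _+ℚ_ (linExt-scaled q) (linExt-⊗ h p q) ⟩
    c *ℚ linExt (λ b → h (mono-mul a b)) q +ℚ _    ∎
    where
    open ≡-Reasoning
    scaled : Poly n → Poly n
    scaled = map (λ u → (c *ℚ proj₁ u , mono-mul a (proj₂ u)))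
    linExt-scaled : ∀ q → linExt h (scaled q) ≡ c *ℚ linExt (λ b → h (mono-mul a b)) q
    linExt-scaled [] = sym (ℚP.*-zeroʳ c)
    linExt-scaled ((d , b) ∷ q) rewrite linExt-scaled q =
      solve 4 (λ c d x w → c :* d :* x :+ c :* w := c :* (d :* x :+ w))
        refl c d (h (mono-mul a b)) (linExt (λ b → h (mono-mul a b)) q)

  linExt-swap : ∀ (g : Mono n → Mono n → ℚ) p q →
    linExt (λ a → linExt (g a) q) p ≡ linExt (λ b → linExt (λ a → g a b) p) q
  linExt-swap g [] q = sym (linExt-zero q)
  linExt-swap g ((c , a) ∷ p) q = begin
    c *ℚ linExt (g a) q +ℚ linExt (λ a → linExt (g a) q) p
      ≡⟨ cong (c *ℚ linExt (g a) q +ℚ_) (linExt-swap g p q) ⟩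
    c *ℚ linExt (g a) q +ℚ linExt (λ b → linExt (λ a → g a b) p) q
      ≡⟨ cong (_+ℚ _) (linExt-* c (g a) q) ⟨
    linExt (λ b → c *ℚ g a b) q +ℚ linExt (λ b → linExt (λ a → g a b) p) q
      ≡⟨ linExt-+ (λ b → c *ℚ g a b) _ q ⟨
    linExt (λ b → c *ℚ g a b +ℚ linExt (λ a → g a b) p) q ∎
    where open ≡-Reasoning

  δ : Mono n → Mono n → ℚ
  δ m m′ = if does (m′ ≟ₘ m) then 1ℚ else 0ℚ

  coeff≡linExt-δ : ∀ p m → coeff p m ≡ linExt (δ m) p
  coeff≡linExt-δ [] m = refl
  coeff≡linExt-δ ((c , m′) ∷ p) m with m′ ≟ₘ m
  ... | yes _ rewrite coeff≡linExt-δ p m | ℚP.*-identityʳ c = refl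
  ... | no _  rewrite coeff≡linExt-δ p m | ℚP.*-zeroʳ c = sym (ℚP.+-identityˡ _)

  remove : Mono n → Poly n → Poly n
  remove a [] = []
  remove a ((c , b) ∷ r) with b ≟ₘ a
  ... | yes _ = remove a r
  ... | no _  = (c , b) ∷ remove a r

  length-remove : ∀ a r → length (remove a r) ≤ length r
  length-remove a [] = z≤n
  length-remove a ((c , b) ∷ r) with b ≟ₘ a
  ... | yes _ = ℕP.m≤n⇒m≤1+n (length-remove a r)
  ... | no _  = s≤s (length-remove a r)

  coeff-remove-≡ : ∀ a r → coeff (remove a r) a ≡ 0ℚ
  coeff-remove-≡ a [] = refl
  coeff-remove-≡ a ((c , b) ∷ r) with b ≟ₘ a
  ... | yes _ = coeff-remove-≡ a r
  ... | no b≢a with b ≟ₘ a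
  ...   | yes b≡a = ⊥-elim (b≢a b≡a)
  ...   | no _    = coeff-remove-≡ a r

  coeff-remove-≢ : ∀ {a m} r → a ≢ m → coeff (remove a r) m ≡ coeff r m
  coeff-remove-≢ [] _ = refl
  coeff-remove-≢ {a} {m} ((c , b) ∷ r) a≢m with b ≟ₘ a
  ... | yes refl with b ≟ₘ m
  ...   | yes b≡m = ⊥-elim (a≢m b≡m)
  ...   | no _    = coeff-remove-≢ r a≢m
  coeff-remove-≢ {a} {m} ((c , b) ∷ r) a≢m | no _ with b ≟ₘ m
  ...   | yes _ = cong (c +ℚ_) (coeff-remove-≢ r a≢m)
  ...   | no _  = coeff-remove-≢ r a≢m

  linExt-remove : ∀ h a r → linExt h r ≡ coeff r a *ℚ h a +ℚ linExt h (remove a r)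
  linExt-remove h a [] = sym (trans (cong (_+ℚ 0ℚ) (ℚP.*-zeroˡ (h a))) (ℚP.+-identityˡ 0ℚ))
  linExt-remove h a ((c , b) ∷ r) with b ≟ₘ a
  ... | yes refl rewrite linExt-remove h b r =
    solve 4 (λ c x y w → c :* x :+ (y :* x :+ w) := (c :+ y) :* x :+ w)
      refl c (h b) (coeff r b) (linExt h (remove b r))
  ... | no _ rewrite linExt-remove h a r =
    solve 4 (λ u v y w → u :+ (y :* v :+ w) := y :* v :+ (u :+ w))
      refl (c *ℚ h b) (h a) (coeff r a) (linExt h (remove a r))

  -- Induction on the length: removing all terms of one monomial keeps every coefficient zero.
  linExt-vanishes : ∀ h r → (∀ m → coeff r m ≡ 0ℚ) → linExt h r ≡ 0ℚ
  linExt-vanishes h r = go (length r) r ℕP.≤-refl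
    where
    go : ∀ k r → length r ≤ k → (∀ m → coeff r m ≡ 0ℚ) → linExt h r ≡ 0ℚ
    go _ [] _ _ = refl
    go (suc k) r@((c , a) ∷ r′) (s≤s |r′|≤k) r≈0 = begin
      linExt h r                                 ≡⟨ linExt-remove h a r ⟩
      coeff r a *ℚ h a +ℚ linExt h (remove a r)  ≡⟨ cong₂ (λ x y → x *ℚ h a +ℚ y) (r≈0 a)
                                                          (go k (remove a r) shorter removed≈0) ⟩
      0ℚ *ℚ h a +ℚ 0ℚ                            ≡⟨ cong (_+ℚ 0ℚ) (ℚP.*-zeroˡ (h a)) ⟩
      0ℚ                                         ∎
      where
      open ≡-Reasoning
      shorter : length (remove a r) ≤ k
      shorter with a ≟ₘ a
      ... | yes _   = ℕP.≤-trans (length-remove a r′) |r′|≤k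
      ... | no a≢a  = ⊥-elim (a≢a refl)
      removed≈0 : ∀ m → coeff (remove a r) m ≡ 0ℚ
      removed≈0 m with a ≟ₘ m
      ... | yes refl = coeff-remove-≡ a r
      ... | no a≢m   = trans (coeff-remove-≢ r a≢m) (r≈0 m)

  -- A record rather than `p ≈ q` itself, so that p and q can be inferred from the type.
  infix 4 _≃_
  record _≃_ (p q : Poly n) : Set where
    constructor mk≃
    field coeff-≡ : p ≈ q

  linExt-resp-≃ : ∀ {p q} → p ≃ q → ∀ h → linExt h p ≡ linExt h q
  linExt-resp-≃ {p} {q} (mk≃ p≈q) h = x∙y⁻¹≈ε⇒x≈y _ _ (begin
    linExt h p +ℚ -ℚ linExt h q   ≡⟨ cong (linExt h p +ℚ_) (linExt-⊖ h q) ⟨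
    linExt h p +ℚ linExt h (⊖ q)  ≡⟨ linExt-++ h p (⊖ q) ⟨
    linExt h (p ++ ⊖ q)           ≡⟨ linExt-vanishes h (p ++ ⊖ q) p-q≈0 ⟩
    0ℚ                            ∎)
    where
    open ≡-Reasoning
    p-q≈0 : ∀ m → coeff (p ++ ⊖ q) m ≡ 0ℚ
    p-q≈0 m = begin
      coeff (p ++ ⊖ q) m                             ≡⟨ coeff≡linExt-δ (p ++ ⊖ q) m ⟩
      linExt (δ m) (p ++ ⊖ q)                        ≡⟨ linExt-++ (δ m) p (⊖ q) ⟩
      linExt (δ m) p +ℚ linExt (δ m) (⊖ q)           ≡⟨ cong (linExt (δ m) p +ℚ_) (linExt-⊖ (δ m) q) ⟩
      linExt (δ m) p +ℚ -ℚ linExt (δ m) q            ≡⟨ cong₂ (λ x y → x +ℚ -ℚ y)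
                                                              (coeff≡linExt-δ p m) (coeff≡linExt-δ q m) ⟨
      coeff p m +ℚ -ℚ coeff q m                      ≡⟨ cong (λ y → coeff p m +ℚ -ℚ y) (p≈q m) ⟨
      coeff p m +ℚ -ℚ coeff p m                      ≡⟨ ℚP.+-inverseʳ (coeff p m) ⟩
      0ℚ                                             ∎

  ≃-by-linExt : ∀ {p q} → (∀ h → linExt h p ≡ linExt h q) → p ≃ q
  ≃-by-linExt {p} {q} eq = mk≃ λ m → trans (coeff≡linExt-δ p m) (trans (eq (δ m)) (sym (coeff≡linExt-δ q m)))

  ≃-refl : ∀ {p} → p ≃ p
  ≃-refl = mk≃ λ _ → refl

  ≃-sym : ∀ {p q} → p ≃ q → q ≃ p
  ≃-sym (mk≃ p≈q) = mk≃ λ m → sym (p≈q m)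

  ≃-trans : ∀ {p q r} → p ≃ q → q ≃ r → p ≃ r
  ≃-trans (mk≃ p≈q) (mk≃ q≈r) = mk≃ λ m → trans (p≈q m) (q≈r m)

  ⊕-cong : ∀ {p p′ q q′} → p ≃ p′ → q ≃ q′ → p ⊕ q ≃ p′ ⊕ q′
  ⊕-cong {p} {p′} {q} {q′} p≃p′ q≃q′ = ≃-by-linExt λ h → begin
    linExt h (p ⊕ q)                ≡⟨ linExt-++ h p q ⟩
    linExt h p +ℚ linExt h q        ≡⟨ cong₂ _+ℚ_ (linExt-resp-≃ p≃p′ h) (linExt-resp-≃ q≃q′ h) ⟩
    linExt h p′ +ℚ linExt h q′      ≡⟨ linExt-++ h p′ q′ ⟨
    linExt h (p′ ⊕ q′)              ∎
    where open ≡-Reasoning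

  ⊖-cong : ∀ {p q} → p ≃ q → ⊖ p ≃ ⊖ q
  ⊖-cong {p} {q} p≃q = ≃-by-linExt λ h →
    trans (linExt-⊖ h p) (trans (cong -ℚ_ (linExt-resp-≃ p≃q h)) (sym (linExt-⊖ h q)))

  ⊗-cong : ∀ {p p′ q q′} → p ≃ p′ → q ≃ q′ → p ⊗ q ≃ p′ ⊗ q′
  ⊗-cong {p} {p′} {q} {q′} p≃p′ q≃q′ = ≃-by-linExt λ h → begin
    linExt h (p ⊗ q)                                         ≡⟨ linExt-⊗ h p q ⟩
    linExt (λ a → linExt (λ b → h (mono-mul a b)) q) p       ≡⟨ linExt-cong (λ a → linExt-resp-≃ q≃q′ _) p ⟩
    linExt (λ a → linExt (λ b → h (mono-mul a b)) q′) p      ≡⟨ linExt-resp-≃ p≃p′ _ ⟩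
    linExt (λ a → linExt (λ b → h (mono-mul a b)) q′) p′     ≡⟨ linExt-⊗ h p′ q′ ⟨
    linExt h (p′ ⊗ q′)                                       ∎
    where open ≡-Reasoning

  ⊕-assoc : ∀ p q r → (p ⊕ q) ⊕ r ≃ p ⊕ (q ⊕ r)
  ⊕-assoc p q r = mk≃ λ m → cong (λ s → coeff s m) (ListP.++-assoc p q r)

  ⊕-comm : ∀ p q → p ⊕ q ≃ q ⊕ p
  ⊕-comm p q = ≃-by-linExt λ h →
    trans (linExt-++ h p q) (trans (ℚP.+-comm (linExt h p) (linExt h q)) (sym (linExt-++ h q p)))

  ⊕-identityˡ : ∀ p → [] ⊕ p ≃ p
  ⊕-identityˡ p = ≃-refl

  ⊖-inverseˡ : ∀ p → ⊖ p ⊕ p ≃ []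
  ⊖-inverseˡ p = ≃-by-linExt λ h →
    trans (linExt-++ h (⊖ p) p) (trans (cong (_+ℚ linExt h p) (linExt-⊖ h p)) (ℚP.+-inverseˡ (linExt h p)))

  ⊗-assoc : ∀ p q r → (p ⊗ q) ⊗ r ≃ p ⊗ (q ⊗ r)
  ⊗-assoc p q r = ≃-by-linExt λ h → begin
    linExt h ((p ⊗ q) ⊗ r)
      ≡⟨ trans (linExt-⊗ h (p ⊗ q) r) (linExt-⊗ _ p q) ⟩
    linExt (λ a → linExt (λ b → linExt (λ c → h (mono-mul (mono-mul a b) c)) r) q) p
      ≡⟨ linExt-cong (λ a → linExt-cong (λ b → linExt-cong (λ c → cong h (mono-mul-assoc a b c)) r) q) p ⟩
    linExt (λ a → linExt (λ b → linExt (λ c → h (mono-mul a (mono-mul b c))) r) q) p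
      ≡⟨ trans (linExt-⊗ h p (q ⊗ r)) (linExt-cong (λ a → linExt-⊗ _ q r) p) ⟨
    linExt h (p ⊗ (q ⊗ r))
      ∎
    where open ≡-Reasoning

  ⊗-comm : ∀ p q → p ⊗ q ≃ q ⊗ p
  ⊗-comm p q = ≃-by-linExt λ h → begin
    linExt h (p ⊗ q)                                          ≡⟨ linExt-⊗ h p q ⟩
    linExt (λ a → linExt (λ b → h (mono-mul a b)) q) p        ≡⟨ linExt-swap (λ a b → h (mono-mul a b)) p q ⟩
    linExt (λ b → linExt (λ a → h (mono-mul a b)) p) q
      ≡⟨ linExt-cong (λ b → linExt-cong (λ a → cong h (mono-mul-comm a b)) p) q ⟩
    linExt (λ b → linExt (λ a → h (mono-mul b a)) p) q        ≡⟨ linExt-⊗ h q p ⟨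
    linExt h (q ⊗ p)                                          ∎
    where open ≡-Reasoning

  ⊗-identityˡ : ∀ p → const 1ℚ ⊗ p ≃ p
  ⊗-identityˡ p = ≃-by-linExt λ h →
    trans (linExt-⊗ h (const 1ℚ) p)
      (trans (ℚP.+-identityʳ _) (trans (ℚP.*-identityˡ _) (linExt-cong (λ b → cong h (mono-mul-identityˡ b)) p)))

  ⊗-distribˡ-⊕ : ∀ p q r → p ⊗ (q ⊕ r) ≃ (p ⊗ q) ⊕ (p ⊗ r)
  ⊗-distribˡ-⊕ p q r = ≃-by-linExt λ h → begin
    linExt h (p ⊗ (q ⊕ r))
      ≡⟨ trans (linExt-⊗ h p (q ⊕ r)) (linExt-cong (λ a → linExt-++ _ q r) p) ⟩
    linExt (λ a → linExt (λ b → h (mono-mul a b)) q +ℚ linExt (λ b → h (mono-mul a b)) r) p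
      ≡⟨ linExt-+ _ _ p ⟩
    linExt (λ a → linExt (λ b → h (mono-mul a b)) q) p +ℚ linExt (λ a → linExt (λ b → h (mono-mul a b)) r) p
      ≡⟨ cong₂ _+ℚ_ (linExt-⊗ h p q) (linExt-⊗ h p r) ⟨
    linExt h (p ⊗ q) +ℚ linExt h (p ⊗ r)
      ≡⟨ linExt-++ h (p ⊗ q) (p ⊗ r) ⟨
    linExt h ((p ⊗ q) ⊕ (p ⊗ r))
      ∎
    where open ≡-Reasoning

  ≃-setoid : Setoid 0ℓ 0ℓ
  ≃-setoid = record
    { Carrier = Poly n ; _≈_ = _≃_
    ; isEquivalence = record { refl = ≃-refl ; sym = ≃-sym ; trans = ≃-trans } }

  poly-isCommutativeRing : IsCommutativeRing _≃_ _⊕_ _⊗_ ⊖_ [] (const 1ℚ)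
  poly-isCommutativeRing = record
    { isRing = record
      { +-isAbelianGroup = record
        { isGroup = record
          { isMonoid = record
            { isSemigroup = record
              { isMagma = record { isEquivalence = Setoid.isEquivalence ≃-setoid ; ∙-cong = ⊕-cong }
              ; assoc = ⊕-assoc }
            ; identity = comm∧idˡ⇒id ≃-setoid ⊕-comm ⊕-identityˡ }
          ; inverse = comm∧invˡ⇒inv ≃-setoid ⊕-comm ⊖-inverseˡ
          ; ⁻¹-cong = ⊖-cong }
        ; comm = ⊕-comm }
      ; *-cong = ⊗-cong
      ; *-assoc = ⊗-assoc
      ; *-identity = comm∧idˡ⇒id ≃-setoid ⊗-comm ⊗-identityˡ
      ; distrib = comm∧distrˡ⇒distr ≃-setoid ⊕-cong ⊗-comm ⊗-distribˡ-⊕ }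
    ; *-comm = ⊗-comm }

  polyRing : AlmostCommutativeRing _ _
  polyRing = fromCommutativeRing (record { isCommutativeRing = poly-isCommutativeRing })

  const-homomorphism : CommutativeRing.rawRing ℚP.+-*-commutativeRing -Raw-AlmostCommutative⟶ polyRing
  const-homomorphism = record
    { ⟦_⟧ = const
    ; +-homo = λ a b → ≃-by-linExt λ h →
        solve 3 (λ a b x → (a :+ b) :* x :+ con 0ℚ := a :* x :+ (b :* x :+ con 0ℚ))
          refl a b (h one-mono)
    ; *-homo = λ a b → ≃-by-linExt λ h → cong (λ z → a *ℚ b *ℚ h z +ℚ 0ℚ) (sym (mono-mul-identityˡ one-mono))
    ; -‿homo = λ a → ≃-refl
    ; 0-homo = ≃-by-linExt λ h → trans (cong (_+ℚ 0ℚ) (ℚP.*-zeroˡ (h one-mono))) (ℚP.+-identityˡ 0ℚ)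
    ; 1-homo = ≃-refl
    }

  const-≟ : ∀ a b → Maybe (const a ≃ const b)
  const-≟ a b with a ℚP.≟ b
  ... | yes refl = just ≃-refl
  ... | no _     = nothing

module _ {n : ℕ} where

  module PolyRing = IsCommutativeRing (poly-isCommutativeRing {n})

  open Algebra.Solver.Ring _ (polyRing {n}) const-homomorphism const-≟ using (solve; _:+_; _:*_; :-_; _:=_; con)

  AllMonos : (Mono n → Set) → Poly n → Set
  AllMonos P = All (P ∘ proj₂)

  OffDiagonal : Poly n → Set
  OffDiagonal = AllMonos DiagonalFree

  DegreeAtMost : ℕ → Poly n → Set
  DegreeAtMost d = AllMonos (λ m → mono-deg m ≤ d)

  AllMonos-⊕ : ∀ {P p q} → AllMonos P p → AllMonos P q → AllMonos P (p ⊕ q)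
  AllMonos-⊕ = AllP.++⁺

  AllMonos-⊖ : ∀ {P p} → AllMonos P p → AllMonos P (⊖ p)
  AllMonos-⊖ = AllP.map⁺

  AllMonos-⊗ : ∀ {P Q R : Mono n → Set} → (∀ {a b} → P a → Q b → R (mono-mul a b)) →
               ∀ {p q} → AllMonos P p → AllMonos Q q → AllMonos R (p ⊗ q)
  AllMonos-⊗ PQ⇒R []        _  = []
  AllMonos-⊗ PQ⇒R (Pa ∷ Pp) Qq = AllP.++⁺ (AllP.map⁺ (All.map (PQ⇒R Pa) Qq)) (AllMonos-⊗ PQ⇒R Pp Qq)

  DegreeAtMost-mono : ∀ {d e p} → d ≤ e → DegreeAtMost d p → DegreeAtMost e p
  DegreeAtMost-mono d≤e = All.map (λ deg≤d → ℕP.≤-trans deg≤d d≤e)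

  ⊗-offDiagonal : ∀ {p q} → OffDiagonal p → OffDiagonal q → OffDiagonal (p ⊗ q)
  ⊗-offDiagonal = AllMonos-⊗ λ {a} {b} → DiagonalFree-mul {a = a} {b = b}

  ⊗-degreeAtMost : ∀ {d e p q} → DegreeAtMost d p → DegreeAtMost e q → DegreeAtMost (d + e) (p ⊗ q)
  ⊗-degreeAtMost = AllMonos-⊗ λ {a} {b} a≤d b≤e → subst (_≤ _) (sym (mono-deg-mul a b)) (ℕP.+-mono-≤ a≤d b≤e)

  const-offDiagonal : ∀ c → OffDiagonal (const c)
  const-offDiagonal c = DiagonalFree-one ∷ []

  const-degreeAtMost : ∀ {d} c → DegreeAtMost d (const c)
  const-degreeAtMost c = subst (_≤ _) (sym (mono-deg-one {n})) z≤n ∷ []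

  var-offDiagonal : ∀ {i j} → i ≢ j → OffDiagonal (var i j)
  var-offDiagonal i≢j = DiagonalFree-var i≢j ∷ []

  var-degreeAtMost : ∀ i j → DegreeAtMost 1 (var i j)
  var-degreeAtMost i j = ℕP.≤-reflexive (mono-deg-var i j) ∷ []

  OffDiagonal⇒InVars : ∀ {p} → OffDiagonal p → InVars p
  OffDiagonal⇒InVars {[]}            []               m c≢0 = ⊥-elim (c≢0 refl)
  OffDiagonal⇒InVars {(c , m′) ∷ p}  (m′-free ∷ free) m c≢0 with m′ ≟ₘ m
  ... | yes refl = m′-free
  ... | no _     = OffDiagonal⇒InVars free m c≢0

  deg≤ : ∀ {d p} → DegreeAtMost d p → deg p ≤ d
  deg≤ {d} {p} = go p
    where
    go : ∀ ts → DegreeAtMost d ts →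
         foldr (λ t acc → if does (coeff p (proj₂ t) ℚP.≟ 0ℚ) then acc else mono-deg (proj₂ t) ⊔ acc) 0 ts ≤ d
    go []                _                = z≤n
    go ((c , m) ∷ ts) (m≤d ∷ ts≤d) with does (coeff p m ℚP.≟ 0ℚ)
    ... | true  = go ts ts≤d
    ... | false = ℕP.⊔-lub m≤d (go ts ts≤d)

  axiomDegree : Axiom n → ℕ
  axiomDegree (ax-bool _ _ _)          = 2
  axiomDegree (ax-anti _ _ _)          = 1
  axiomDegree (ax-trans _ _ _ _ _ _)   = 3

  axiom-degreeAtMost : ∀ s → DegreeAtMost (axiomDegree s) (axiomPoly s)
  axiom-degreeAtMost (ax-bool i j _) =
    AllMonos-⊕ (⊗-degreeAtMost (var-degreeAtMost i j) (var-degreeAtMost i j))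
               (AllMonos-⊖ (DegreeAtMost-mono (ℕP.n≤1+n 1) (var-degreeAtMost i j)))
  axiom-degreeAtMost (ax-anti i j _) =
    AllMonos-⊕ (var-degreeAtMost i j) (AllMonos-⊖ (AllMonos-⊕ (const-degreeAtMost 1ℚ) (AllMonos-⊖ (var-degreeAtMost j i))))
  axiom-degreeAtMost (ax-trans i j k _ _ _) =
    ⊗-degreeAtMost (⊗-degreeAtMost (var-degreeAtMost i j) (var-degreeAtMost j k))
                   (AllMonos-⊕ (const-degreeAtMost 1ℚ) (AllMonos-⊖ (var-degreeAtMost i k)))

  -- Degree-bounded derivations from the axioms

  combination : List (Poly n × Axiom n) → Poly n
  combination cert = sumPoly (map (λ t → proj₁ t ⊗ axiomPoly (proj₂ t)) cert)

  Bounded : ℕ → Poly n × Axiom n → Set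
  Bounded d (f , s) = OffDiagonal f × Σ ℕ λ e → DegreeAtMost e f × e + axiomDegree s ≤ d

  Derivable : ℕ → Poly n → Set
  Derivable d p = Σ (List (Poly n × Axiom n)) λ cert → All (Bounded d) cert × p ≃ combination cert

  Derivable-resp : ∀ {d p q} → p ≃ q → Derivable d q → Derivable d p
  Derivable-resp p≃q (cert , bounded , q≃cert) = cert , bounded , ≃-trans p≃q q≃cert

  Derivable-mono : ∀ {d d′ p} → d ≤ d′ → Derivable d p → Derivable d′ p
  Derivable-mono d≤d′ (cert , bounded , p≃cert) =
    cert , All.map (λ (free , e , f≤e , e+s≤d) → free , e , f≤e , ℕP.≤-trans e+s≤d d≤d′) bounded , p≃cert

  Derivable-≃ : ∀ {d p q} → p ≃ q → Derivable d (p ⊕ ⊖ q)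
  Derivable-≃ {p = p} p≃q = [] , [] , ≃-trans (⊕-cong ≃-refl (⊖-cong (≃-sym p≃q))) (PolyRing.-‿inverseʳ p)

  Derivable-axiom : ∀ {d e f} s → OffDiagonal f → DegreeAtMost e f → e + axiomDegree s ≤ d → Derivable d (f ⊗ axiomPoly s)
  Derivable-axiom {e = e} {f} s free f≤e e+s≤d =
    [ (f , s) ] , (free , e , f≤e , e+s≤d) ∷ [] , ≃-sym (PolyRing.+-identityʳ (f ⊗ axiomPoly s))

  Derivable-axiomPoly : ∀ s → Derivable (axiomDegree s) (const 1ℚ ⊗ axiomPoly s)
  Derivable-axiomPoly s = Derivable-axiom s (const-offDiagonal 1ℚ) (const-degreeAtMost {0} 1ℚ) ℕP.≤-refl

  combination-++ : ∀ cert cert′ → combination (cert ++ cert′) ≃ combination cert ⊕ combination cert′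
  combination-++ cert cert′ = mk≃ λ m → cong (λ r → coeff r m) (begin
    sumPoly (map _ (cert ++ cert′))             ≡⟨ cong sumPoly (ListP.map-++ _ cert cert′) ⟩
    sumPoly (map _ cert ++ map _ cert′)         ≡⟨ ListP.concat-++ (map _ cert) (map _ cert′) ⟨
    combination cert ⊕ combination cert′        ∎)
    where open ≡-Reasoning

  Derivable-⊕ : ∀ {d p q} → Derivable d p → Derivable d q → Derivable d (p ⊕ q)
  Derivable-⊕ (cert , bounded , p≃cert) (cert′ , bounded′ , q≃cert′) =
    cert ++ cert′ , AllP.++⁺ bounded bounded′ , ≃-trans (⊕-cong p≃cert q≃cert′) (≃-sym (combination-++ cert cert′))

  Derivable-⊗ : ∀ {d e g p} → OffDiagonal g → DegreeAtMost e g → Derivable d p → Derivable (e + d) (g ⊗ p)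
  Derivable-⊗ {d} {e} {g} g-free g≤e (cert , bounded , p≃cert) =
    map scale cert , AllP.map⁺ (All.map scale-bounded bounded) ,
    ≃-trans (⊗-cong (≃-refl {p = g}) p≃cert) (≃-sym (combination-scale cert))
    where
    scale : Poly n × Axiom n → Poly n × Axiom n
    scale (f , s) = g ⊗ f , s
    scale-bounded : ∀ {t} → Bounded d t → Bounded (e + d) (scale t)
    scale-bounded {f , s} (f-free , e′ , f≤e′ , e′+s≤d) =
      ⊗-offDiagonal g-free f-free , e + e′ , ⊗-degreeAtMost g≤e f≤e′ ,
      subst (_≤ e + d) (sym (ℕP.+-assoc e e′ (axiomDegree s))) (ℕP.+-monoʳ-≤ e e′+s≤d)
    combination-scale : ∀ cert → combination (map scale cert) ≃ g ⊗ combination cert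
    combination-scale [] = ≃-sym (PolyRing.zeroʳ g)
    combination-scale ((f , s) ∷ cert) = ≃-trans (⊕-cong ≃-refl (combination-scale cert))
      (solve 4 (λ g f s c → g :* f :* s :+ g :* c := g :* (f :* s :+ c)) ≃-refl g f (axiomPoly s) (combination cert))

  Derivable-⊖ : ∀ {d p} → Derivable d p → Derivable d (⊖ p)
  Derivable-⊖ {p = p} derivable = Derivable-resp (solve 1 (λ p → :- p := con (-ℚ 1ℚ) :* p) ≃-refl p)
    (Derivable-⊗ (const-offDiagonal (-ℚ 1ℚ)) (const-degreeAtMost (-ℚ 1ℚ)) derivable)

  Derivable-sum : ∀ {d} {A : Set} (f g : A → Poly n) xs → All (λ x → Derivable d (f x ⊕ ⊖ g x)) xs →
                  Derivable d (sumPoly (map f xs) ⊕ ⊖ sumPoly (map g xs))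
  Derivable-sum f g []       []                  = [] , [] , ≃-refl
  Derivable-sum f g (x ∷ xs) (derivable ∷ derivables) =
    Derivable-resp (solve 4 (λ p s q t → (p :+ s) :+ :- (q :+ t) := (p :+ :- q) :+ (s :+ :- t)) ≃-refl
                      (f x) (sumPoly (map f xs)) (g x) (sumPoly (map g xs)))
      (Derivable-⊕ derivable (Derivable-sum f g xs derivables))

  pathProd′-offDiagonal : ∀ {a ρ} → Unique (a ∷ ρ) → OffDiagonal (pathProd' a ρ)
  pathProd′-offDiagonal {ρ = []}    _                      = const-offDiagonal 1ℚ
  pathProd′-offDiagonal {ρ = b ∷ ρ} ((a≢b ∷ _) ∷ distinct) =
    ⊗-offDiagonal (var-offDiagonal a≢b) (pathProd′-offDiagonal distinct)

  pathProd′-degreeAtMost : ∀ a ρ → DegreeAtMost (length ρ) (pathProd' a ρ)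
  pathProd′-degreeAtMost a []      = const-degreeAtMost 1ℚ
  pathProd′-degreeAtMost a (b ∷ ρ) = ⊗-degreeAtMost (var-degreeAtMost a b) (pathProd′-degreeAtMost b ρ)

  -- Reading x_ij as i < j: from a < x and a < b, either a < x < b or a < b < x.
  betweenness : ∀ {a x b} → a ≢ x → x ≢ b → a ≢ b →
    Derivable 3 (var a x ⊗ var x b ⊕ var a b ⊗ var b x ⊕ ⊖ (var a x ⊗ var a b))
  betweenness {a} {x} {b} a≢x x≢b a≢b =
    Derivable-resp
      (solve 4 (λ A B C E → A :* B :+ C :* E :+ :- (A :* C) :=
                  con 1ℚ :* (A :* B :* (con 1ℚ :+ :- C)) :+
                  (con 1ℚ :* (C :* E :* (con 1ℚ :+ :- A)) :+ A :* C :* (B :+ :- (con 1ℚ :+ :- E))))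
        ≃-refl (var a x) (var x b) (var a b) (var b x))
      (Derivable-⊕ (Derivable-axiomPoly (ax-trans a x b a≢x x≢b a≢b))
      (Derivable-⊕ (Derivable-axiomPoly (ax-trans a b x a≢b (x≢b ∘ sym) a≢x))
                   (Derivable-axiom (ax-anti x b x≢b) (⊗-offDiagonal (var-offDiagonal a≢x) (var-offDiagonal a≢b))
                      (⊗-degreeAtMost (var-degreeAtMost a x) (var-degreeAtMost a b)) ℕP.≤-refl)))

  insertionSum : Fin n → Fin n → List (Fin n) → Poly n
  insertionSum x a ρ = sumPoly (map (pathProd' a) (insertions x ρ))

  sumPoly-pathProd′-∷ : ∀ a b τs →
    sumPoly (map (pathProd' a) (map (b ∷_) τs)) ≃ var a b ⊗ sumPoly (map (pathProd' b) τs)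
  sumPoly-pathProd′-∷ a b []       = ≃-sym (PolyRing.zeroʳ (var a b))
  sumPoly-pathProd′-∷ a b (τ ∷ τs) =
    ≃-trans (⊕-cong ≃-refl (sumPoly-pathProd′-∷ a b τs))
            (≃-sym (PolyRing.distribˡ (var a b) (pathProd' b τ) (sumPoly (map (pathProd' b) τs))))

  insertionSum-derivable : ∀ {x a ρ} → Unique (a ∷ ρ) → All (x ≢_) (a ∷ ρ) →
    Derivable (2 + length ρ) (insertionSum x a ρ ⊕ ⊖ (var a x ⊗ pathProd' a ρ))
  insertionSum-derivable {x} {a} {[]} _ _ = Derivable-≃ (PolyRing.+-identityʳ (var a x ⊗ const 1ℚ))
  insertionSum-derivable {x} {a} {b ∷ ρ} distinct@((a≢b ∷ _) ∷ distinct′) (x≢a ∷ x≢b ∷ x∉ρ) =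
    Derivable-resp identity
      (Derivable-⊕ (Derivable-⊗ (var-offDiagonal a≢b) (var-degreeAtMost a b) (insertionSum-derivable distinct′ (x≢b ∷ x∉ρ)))
                   (Derivable-mono (ℕP.≤-reflexive (ℕP.+-comm (length ρ) 3))
                      (Derivable-⊗ (pathProd′-offDiagonal distinct′) (pathProd′-degreeAtMost b ρ)
                         (betweenness (x≢a ∘ sym) x≢b a≢b))))
    where
    A B C E Q T : Poly n
    A = var a x
    B = var x b
    C = var a b
    E = var b x
    Q = pathProd' b ρ
    T = insertionSum x b ρ
    identity : insertionSum x a (b ∷ ρ) ⊕ ⊖ (A ⊗ (C ⊗ Q)) ≃
               C ⊗ (T ⊕ ⊖ (E ⊗ Q)) ⊕ Q ⊗ (A ⊗ B ⊕ C ⊗ E ⊕ ⊖ (A ⊗ C))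
    identity = ≃-trans (⊕-cong (⊕-cong (≃-refl {p = A ⊗ (B ⊗ Q)}) (sumPoly-pathProd′-∷ a b (insertions x ρ))) ≃-refl)
      (solve 6 (λ A B C E Q T → A :* (B :* Q) :+ C :* T :+ :- (A :* (C :* Q)) :=
                  C :* (T :+ :- (E :* Q)) :+ Q :* (A :* B :+ C :* E :+ :- (A :* C)))
        ≃-refl A B C E Q T)

  insertions-derivable : ∀ {x σ} → Unique σ → All (x ≢_) σ →
    Derivable (1 + length σ) (pathProd σ ⊕ ⊖ sumPoly (map pathProd (insertions x σ)))
  insertions-derivable {x} {[]} _ _ = Derivable-≃ (≃-sym (PolyRing.+-identityʳ (const 1ℚ)))
  insertions-derivable {x} {a ∷ ρ} distinct x∉σ@(x≢a ∷ _) =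
    Derivable-resp identity
      (Derivable-⊕ (Derivable-⊖ (insertionSum-derivable distinct x∉σ))
                   (Derivable-⊖ (Derivable-axiom (ax-anti x a x≢a) (pathProd′-offDiagonal distinct)
                      (pathProd′-degreeAtMost a ρ) (ℕP.≤-trans (ℕP.≤-reflexive (ℕP.+-comm (length ρ) 1)) (ℕP.n≤1+n _)))))
    where
    Q : Poly n
    Q = pathProd' a ρ
    identity : Q ⊕ ⊖ (var x a ⊗ Q ⊕ sumPoly (map pathProd (map (a ∷_) (insertions x ρ)))) ≃
               ⊖ (insertionSum x a ρ ⊕ ⊖ (var a x ⊗ Q)) ⊕ ⊖ (Q ⊗ axiomPoly (ax-anti x a x≢a))
    identity rewrite sym (ListP.map-∘ {g = pathProd} {f = a ∷_} (insertions x ρ)) =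
      solve 4 (λ Q X Y T → Q :+ :- (X :* Q :+ T) := :- (T :+ :- (Y :* Q)) :+ :- (Q :* (X :+ :- (con 1ℚ :+ :- Y))))
        ≃-refl Q (var x a) (var a x) (insertionSum x a ρ)

  sumPoly-concatMap : ∀ {A B : Set} (f : B → Poly n) (g : A → List B) xs →
    sumPoly (map f (concatMap g xs)) ≡ sumPoly (map (λ x → sumPoly (map f (g x))) xs)
  sumPoly-concatMap f g xs = begin
    concat (map f (concatMap g xs))              ≡⟨ cong concat (ListP.map-concatMap f g xs) ⟩
    concat (concat (map (map f ∘ g) xs))         ≡⟨ ListP.concat-concat (map (map f ∘ g) xs) ⟨
    concat (map concat (map (map f ∘ g) xs))     ≡⟨ cong concat (ListP.map-∘ xs) ⟨
    concat (map (concat ∘ map f ∘ g) xs)         ∎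
    where open ≡-Reasoning

  perms-derivable : ∀ L → Unique L → Derivable (length L) (const 1ℚ ⊕ ⊖ sumPoly (map pathProd (perms L)))
  perms-derivable []       _            = Derivable-≃ (≃-sym (PolyRing.+-identityʳ (const 1ℚ)))
  perms-derivable (x ∷ xs) (x∉xs ∷ distinct) =
    Derivable-resp identity
      (Derivable-⊕ (Derivable-mono (ℕP.n≤1+n _) (perms-derivable xs distinct))
                   (Derivable-sum pathProd sumOverInsertions (perms xs) (All.map insertions-of-perm (perms-↭ xs))))
    where
    sumOverInsertions : List (Fin n) → Poly n
    sumOverInsertions σ = sumPoly (map pathProd (insertions x σ))
    S : Poly n
    S = sumPoly (map pathProd (perms xs))
    insertions-of-perm : ∀ {σ} → σ ↭ xs → Derivable (1 + length xs) (pathProd σ ⊕ ⊖ sumOverInsertions σ)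
    insertions-of-perm {σ} σ↭xs = subst (λ l → Derivable (1 + l) _) (↭-length σ↭xs)
      (insertions-derivable (Unique-resp-↭ (↭-sym σ↭xs) distinct) (All-resp-↭ (↭-sym σ↭xs) x∉xs))
    identity : const 1ℚ ⊕ ⊖ sumPoly (map pathProd (perms (x ∷ xs))) ≃
               (const 1ℚ ⊕ ⊖ S) ⊕ (S ⊕ ⊖ sumPoly (map sumOverInsertions (perms xs)))
    identity rewrite sumPoly-concatMap pathProd (insertions x) (perms xs) =
      solve 2 (λ S T → con 1ℚ :+ :- T := (con 1ℚ :+ :- S) :+ (S :+ :- T)) ≃-refl S (sumPoly (map sumOverInsertions (perms xs)))

corollary4p9 : (n k : ℕ) (ι : Fin k → Fin n) → Injective _≡_ _≡_ ι →
    Σ (List (Poly n × Axiom n)) λ cert →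
    All (λ t → InVars (proj₁ t) × deg (proj₁ t) + deg (axiomPoly (proj₂ t)) ≤ k + 1) cert
    × (const 1ℚ ⊕ ⊖ sumPoly (map pathProd (perms (map ι (allFin k))))
    ≈ sumPoly (map (λ t → proj₁ t ⊗ axiomPoly (proj₂ t)) cert))
corollary4p9 n k ι ι-injective =
  let cert , bounded , identity = Derivable-mono length≤k+1 (perms-derivable L distinct)
  in  cert , All.map degree-bound bounded , _≃_.coeff-≡ identity
  where
  L : List (Fin n)
  L = map ι (allFin k)
  distinct : Unique L
  distinct = UniqueP.map⁺ ι-injective (UniqueP.allFin⁺ k)
  length≤k+1 : length L ≤ k + 1
  length≤k+1 = subst (_≤ k + 1) (sym (trans (ListP.length-map ι (allFin k)) (ListP.length-tabulate id))) (ℕP.m≤m+n k 1)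
  degree-bound : ∀ {t} → Bounded (k + 1) t → InVars (proj₁ t) × deg (proj₁ t) + deg (axiomPoly (proj₂ t)) ≤ k + 1
  degree-bound {f , s} (f-free , e , f≤e , e+s≤k+1) =
    OffDiagonal⇒InVars f-free , ℕP.≤-trans (ℕP.+-mono-≤ (deg≤ f≤e) (deg≤ (axiom-degreeAtMost s))) e+s≤k+1
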